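{- Let $\Gamma$ be a strongly regular graph with parameters $(n,k,\lambda,\mu)$ and let $(x,z)$, $x\neq z$, be a $3$-isoregular non-edge of $\Gamma$ with associated parameters $R',W',V$. Then (i) $\mu(\lambda-R')=(k-\mu)W'$; (ii) $\mu(k-2-2\lambda+R')=V\left(\frac{k(k-\lambda-1)}{\mu}-k+\mu-1\right)$.
   Context: All graphs are finite, simple and connected. A strongly regular graph with parameters $(n,k,\lambda,\mu)$ is a $k$-regular graph on $n$ vertices in which adjacent vertices have exactly $\lambda$ common neighbours and distinct non-adjacent vertices have exactly $\mu$ common neighbours; it is assumed non-trivial, i.e. both it and its complement are connected. For a vertex set $T$, the valency of $T$ is the number of vertices adjacent to every vertex of $T$. An ordered pair $(x,z)$ of distinct vertices is $3$-isoregular if for all vertices $u\ne x,z$ the valency of $\{x,z,u\}$ depends only on the isomorphism type of the subgraph induced on $\{x,z,u\}$. If $x\not\sim z$ and $(x,z)$ is $3$-isoregular, its associated parameters $R',W',V$ are the valencies of $\{x,z,u\}$ when the induced subgraph on $\{x,z,u\}$ is isomorphic to $K_{1,2}$, to $K_2+K_1$, or to $3K_1$ (no edges), respectively. -}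

module Defs where

open import Data.Nat using (ℕ; zero; suc; _+_)
open import Data.Bool using (Bool; true; false; _∧_; not)
open import Data.Fin using (Fin)
open import Data.List using (List; length; filter)
open import Data.List using (allFin)
open import Data.Fin.Subset using (Subset; _∈_)
open import Relation.Binary.PropositionalEquality using (_≡_; _≢_)
open import Relation.Nullary using (¬_)
open import Relation.Nullary.Decidable using (Dec)
open import Data.Bool using (T; T?)

record Graph (n : ℕ) : Set where
  field
    adj   : Fin n → Fin n → Bool
    adj-sym : ∀ x y → adj x y ≡ adj y x
    adj-irrefl : ∀ x → adj x x ≡ false

open Graph public

_∼[_]_ : ∀ {n} → Fin n → Graph n → Fin n → Set
x ∼[ G ] y = adj G x y ≡ true

complement : ∀ {n} → Graph n → Graph n
complement G = record
  { adj = λ x y → not (adj G x y) ∧ not (x ≡ᵇ y)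
  ; adj-sym = λ x y → symC x y
  ; adj-irrefl = λ x → irrC x }
  where
    open import Data.Fin using () renaming (_≟_ to _≟F_)
    open import Relation.Nullary.Decidable using (⌊_⌋)
    open import Relation.Binary.PropositionalEquality using (refl; cong₂; sym)
    open import Data.Bool.Properties using (∧-zeroʳ)
    _≡ᵇ_ : Fin _ → Fin _ → Bool
    a ≡ᵇ b = ⌊ a ≟F b ⌋
    symEq : ∀ a b → (a ≡ᵇ b) ≡ (b ≡ᵇ a)
    symEq a b with a ≟F b | b ≟F a
    ... | Relation.Nullary.yes _ | Relation.Nullary.yes _ = refl
    ... | Relation.Nullary.no _  | Relation.Nullary.no _  = refl
    ... | Relation.Nullary.yes p | Relation.Nullary.no q  = Data.Empty.⊥-elim (q (sym p))
      where import Data.Empty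
    ... | Relation.Nullary.no p  | Relation.Nullary.yes q = Data.Empty.⊥-elim (p (sym q))
      where import Data.Empty
    symC : ∀ a b → (not (adj G a b) ∧ not (a ≡ᵇ b)) ≡ (not (adj G b a) ∧ not (b ≡ᵇ a))
    symC a b = cong₂ (λ u v → not u ∧ not v) (Graph.adj-sym G a b) (symEq a b)
    irrC : ∀ a → (not (adj G a a) ∧ not (a ≡ᵇ a)) ≡ false
    irrC a with a ≟F a
    ... | Relation.Nullary.yes _ = ∧-zeroʳ (not (adj G a a))
    ... | Relation.Nullary.no ¬p = Data.Empty.⊥-elim (¬p refl)
      where import Data.Empty

data Reachable {n} (G : Graph n) : Fin n → Fin n → Set where
  here : ∀ {x} → Reachable G x x
  step : ∀ {x y z} → x ∼[ G ] y → Reachable G y z → Reachable G x z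

Connected : ∀ {n} → Graph n → Set
Connected {n} G = ∀ (x y : Fin n) → Reachable G x y

count : ∀ {n} → (Fin n → Bool) → ℕ
count {n} p = length (filter (λ w → T? (p w)) (allFin n))

valency : ∀ {n} → Graph n → List (Fin n) → ℕ
valency G T = count (λ w → allAdj w T)
  where
    allAdj : _ → List _ → Bool
    allAdj w List.[] = true
    allAdj w (t List.∷ ts) = adj G t w ∧ allAdj w ts
      where import Data.List as List

-- Strongly regular graph with parameters (n,k,λ,μ), non-trivial
-- (the graph and its complement are connected).
record IsSRG (n k λ' μ : ℕ) (G : Graph n) : Set where
  field
    regular   : ∀ x → valency G (x Data.List.∷ Data.List.[]) ≡ k
    adjCommon : ∀ x y → x ∼[ G ] y → valency G (x Data.List.∷ y Data.List.∷ Data.List.[]) ≡ λ'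
    nonadjCommon : ∀ x y → x ≢ y → ¬ (x ∼[ G ] y) →
                   valency G (x Data.List.∷ y Data.List.∷ Data.List.[]) ≡ μ
    connected  : Connected G
    coConnected : Connected (complement G)

-- Number of edges induced on {x,z,u}; for three distinct vertices this
-- number determines (and is determined by) the isomorphism type of the
-- induced subgraph: 0 ↦ 3K₁, 1 ↦ K₂+K₁, 2 ↦ K₁,₂, 3 ↦ K₃.
b2n : Bool → ℕ
b2n true = 1
b2n false = 0

edgesOn : ∀ {n} → Graph n → Fin n → Fin n → Fin n → ℕ
edgesOn G x z u = b2n (adj G x z) + b2n (adj G x u) + b2n (adj G z u)

valency3 : ∀ {n} → Graph n → Fin n → Fin n → Fin n → ℕ
valency3 G x z u = valency G (x Data.List.∷ z Data.List.∷ u Data.List.∷ Data.List.[])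

ThreeIsoregular : ∀ {n} → Graph n → Fin n → Fin n → Set
ThreeIsoregular G x z = ∀ u u' → u ≢ x → u ≢ z → u' ≢ x → u' ≢ z →
  edgesOn G x z u ≡ edgesOn G x z u' → valency3 G x z u ≡ valency3 G x z u'

-- Associated parameters of a 3-isoregular non-edge (x,z):
-- R' for type K₁,₂ (2 edges), W' for K₂+K₁ (1 edge), V for 3K₁ (0 edges).
record AssocParams {n} (G : Graph n) (x z : Fin n) (R' W' V : ℕ) : Set where
  field
    R'-val : ∀ u → u ≢ x → u ≢ z → edgesOn G x z u ≡ 2 → valency3 G x z u ≡ R'
    W'-val : ∀ u → u ≢ x → u ≢ z → edgesOn G x z u ≡ 1 → valency3 G x z u ≡ W'
    V-val  : ∀ u → u ≢ x → u ≢ z → edgesOn G x z u ≡ 0 → valency3 G x z u ≡ V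

{-# OPTIONS --safe #-}
module Submission where

-- Let C = Γ(x) ∩ Γ(z) be the μ common neighbours of the non-edge. Every u ∈ C has λ − R′
-- neighbours in Γ(x) ∖ Γ(z), a set of k − μ vertices each of which has W′ neighbours in C;
-- counting the edges between the two sets in both ways gives (i). The k neighbours of
-- u ∈ C are x, z, R′ vertices of C and λ − R′ vertices in each of Γ(x) ∖ Γ(z) and
-- Γ(z) ∖ Γ(x); the remaining k − 2 − 2λ + R′ lie in F = Δ(x) ∩ Δ(z), where Δ(v) is the set
-- of non-neighbours of v other than v, and each vertex of F has V neighbours in C. Double
-- counting again gives μ(k − 2 − 2λ + R′) = V·|F|, and |F| = |Δ(x)| − (k − μ) − 1 with
-- |Δ(x)| = k(k − λ − 1)/μ by the classical double count of the edges between Γ(x) and Δ(x).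

open import Data.Bool using (Bool; true; false; _∧_; not; T?)
open import Data.Empty using (⊥-elim)
open import Data.Fin using (Fin; zero; suc; _≟_)
open import Data.List using ([]; _∷_)
open import Data.Product using (_×_; _,_; proj₁; proj₂)
open import Function using (_∘_; id)
open import Relation.Binary.PropositionalEquality
open import Relation.Nullary using (¬_)
open import Relation.Nullary.Decidable using (does; yes; no)

open import Defs

module _ where
  open import Data.Bool.Properties using (∧-identityʳ; ∧-assoc; ∧-comm; not-injective; not-¬)
  open import Data.List using (length; filter; tabulate)
  open import Data.Nat using (ℕ; zero; suc; _+_; _*_; _∸_)
  open import Data.Nat.Properties
    using (+-*-semiring; +-comm; +-identityʳ; *-identityˡ; *-identityʳ; *-distribʳ-+; *-distribˡ-+;
           *-distribˡ-∸; ∸-+-assoc; m+n∸m≡n)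
  open import Data.Nat.Solver using (module +-*-Solver)
  open import Algebra.Properties.Semiring.Sum +-*-semiring
    using (sum; sum-syntax; sum-cong-≗; ∑-distrib-+; ∑-comm; *-distribˡ-sum; *-distribʳ-sum;
           sum-replicate-zero)

  private variable
    n m c : ℕ
    X Y : Fin n → Bool
    f g h : Fin n → ℕ

  -- Finite sums over vertex sets

  𝟙 : (Fin n → Bool) → Fin n → ℕ
  𝟙 X w = b2n (X w)

  ∣_∣ : (Fin n → Bool) → ℕ
  ∣_∣ {n} X = ∑[ w < n ] 𝟙 X w

  infixr 7 _∩_ _∖_

  _∩_ _∖_ : (Fin n → Bool) → (Fin n → Bool) → Fin n → Bool
  (X ∩ Y) w = X w ∧ Y w
  (X ∖ Y) w = X w ∧ not (Y w)

  -- Written with does rather than ⌊_⌋ so that ｛ suc x ｝ (suc w) reduces to ｛ x ｝ w.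
  ｛_｝ : Fin n → Fin n → Bool
  ｛ x ｝ w = does (w ≟ x)

  ∧-true : ∀ {p q} → p ∧ q ≡ true → p ≡ true × q ≡ true
  ∧-true {true} {true} _ = refl , refl

  b2n-∧ : ∀ p q → b2n (p ∧ q) ≡ b2n p * b2n q
  b2n-∧ true  true  = refl
  b2n-∧ true  false = refl
  b2n-∧ false q     = refl

  𝟙-split : ∀ (X Y : Fin n → Bool) w → 𝟙 X w ≡ 𝟙 (X ∩ Y) w + 𝟙 (X ∖ Y) w
  𝟙-split X Y w with X w | Y w
  ... | true  | true  = refl
  ... | true  | false = refl
  ... | false | _     = refl

  length-filter-tabulate : ∀ (X : Fin n → Bool) (v : Fin m → Fin n) →
    length (filter (T? ∘ X) (tabulate v)) ≡ ∑[ i < m ] 𝟙 X (v i)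
  length-filter-tabulate {m = zero}  X v = refl
  length-filter-tabulate {m = suc m} X v with X (v zero)
  ... | true  = cong suc (length-filter-tabulate X (v ∘ suc))
  ... | false = length-filter-tabulate X (v ∘ suc)

  count≡∣∣ : ∀ (X : Fin n → Bool) → count X ≡ ∣ X ∣
  count≡∣∣ X = length-filter-tabulate X id

  ∑-split : (∀ w → f w ≡ g w + h w) → ∑[ w < n ] f w ≡ ∑[ w < n ] g w + ∑[ w < n ] h w
  ∑-split {g = g} {h = h} f≗g+h = trans (sum-cong-≗ f≗g+h) (∑-distrib-+ g h)

  ∑-split₃ : ∀ {n} {f g₁ g₂ g₃ : Fin n → ℕ} → (∀ w → f w ≡ g₁ w + g₂ w + g₃ w) →
    sum f ≡ sum g₁ + sum g₂ + sum g₃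
  ∑-split₃ {g₁ = g₁} {g₂} {g₃} f≗g = trans (∑-split f≗g) (cong (_+ sum g₃) (∑-distrib-+ g₁ g₂))

  ∣∣-split : ∀ (X Y : Fin n → Bool) → ∣ X ∣ ≡ ∣ X ∩ Y ∣ + ∣ X ∖ Y ∣
  ∣∣-split X Y = ∑-split (𝟙-split X Y)

  ∑-𝟙-cong : (∀ w → X w ≡ true → f w ≡ g w) →
    ∑[ w < n ] (𝟙 X w * f w) ≡ ∑[ w < n ] (𝟙 X w * g w)
  ∑-𝟙-cong {X = X} {f = f} {g = g} f≡g-on-X = sum-cong-≗ pointwise
    where
    pointwise : ∀ w → 𝟙 X w * f w ≡ 𝟙 X w * g w
    pointwise w with X w | f≡g-on-X w
    ... | true  | f≡g = cong (1 *_) (f≡g refl)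
    ... | false | _   = refl

  ∑-𝟙-const : (∀ w → X w ≡ true → f w ≡ c) → ∑[ w < n ] (𝟙 X w * f w) ≡ ∣ X ∣ * c
  ∑-𝟙-const {X = X} {c = c} f≡c-on-X = trans (∑-𝟙-cong f≡c-on-X) (sym (*-distribʳ-sum c (𝟙 X)))

  ∑-𝟙｛｝ : ∀ {n} (f : Fin n → ℕ) x → ∑[ w < n ] (𝟙 ｛ x ｝ w * f w) ≡ f x
  ∑-𝟙｛｝ {suc n} f zero = begin
    1 * f zero + sum {n} (λ _ → 0) ≡⟨ cong (λ s → 1 * f zero + s) (sum-replicate-zero n) ⟩
    1 * f zero + 0                 ≡⟨ +-identityʳ _ ⟩
    1 * f zero                     ≡⟨ *-identityˡ _ ⟩
    f zero                         ∎
    where open ≡-Reasoning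
  ∑-𝟙｛｝ {suc n} f (suc x) = ∑-𝟙｛｝ (f ∘ suc) x

  ∣｛｝∣≡1 : ∀ (x : Fin n) → ∣ ｛ x ｝ ∣ ≡ 1
  ∣｛｝∣≡1 x = trans (sum-cong-≗ (λ w → sym (*-identityʳ (𝟙 ｛ x ｝ w)))) (∑-𝟙｛｝ (λ _ → 1) x)

  -- Degrees and double counting

  module Degrees {n} (G : Graph n) where

    Γ : Fin n → Fin n → Bool
    Γ = adj G

    Δ : Fin n → Fin n → Bool
    Δ x w = not (adj G x w) ∧ not (does (w ≟ x))

    deg : (Fin n → ℕ) → Fin n → ℕ
    deg f u = ∑[ w < n ] (f w * 𝟙 (Γ u) w)

    adj⇒≢ : ∀ {x u} → adj G x u ≡ true → u ≢ x
    adj⇒≢ {x} x∼u refl = not-¬ (adj-irrefl G x) x∼u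

    Δ-elim : ∀ x w → Δ x w ≡ true → adj G x w ≡ false × w ≢ x
    Δ-elim x w w∈Δx with adj G x w | w ≟ x
    ... | false | no w≢x = refl , w≢x

    valency-[u] : ∀ u → valency G (u ∷ []) ≡ ∣ Γ u ∣
    valency-[u] u = trans (count≡∣∣ (λ w → adj G u w ∧ true))
      (sum-cong-≗ (λ w → cong b2n (∧-identityʳ (adj G u w))))

    valency-[u,v] : ∀ u v → valency G (u ∷ v ∷ []) ≡ ∣ Γ u ∩ Γ v ∣
    valency-[u,v] u v = trans (count≡∣∣ (λ w → adj G u w ∧ adj G v w ∧ true))
      (sum-cong-≗ (λ w → cong (λ p → b2n (adj G u w ∧ p)) (∧-identityʳ (adj G v w))))

    valency3≡deg : ∀ x z u → valency3 G x z u ≡ deg (𝟙 (Γ x ∩ Γ z)) u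
    valency3≡deg x z u =
      trans (count≡∣∣ (λ w → adj G x w ∧ adj G z w ∧ adj G u w ∧ true)) (sum-cong-≗ pointwise)
      where
      pointwise : ∀ w → b2n (adj G x w ∧ adj G z w ∧ adj G u w ∧ true) ≡ 𝟙 (Γ x ∩ Γ z) w * 𝟙 (Γ u) w
      pointwise w rewrite ∧-identityʳ (adj G u w) | sym (∧-assoc (adj G x w) (adj G z w) (adj G u w)) =
        b2n-∧ (adj G x w ∧ adj G z w) (adj G u w)

    deg≡∣∩Γ∣ : ∀ X u → deg (𝟙 X) u ≡ ∣ X ∩ Γ u ∣
    deg≡∣∩Γ∣ X u = sum-cong-≗ (λ w → sym (b2n-∧ (X w) (adj G u w)))

    deg-split : ∀ (X Y : Fin n → Bool) u → deg (𝟙 X) u ≡ deg (𝟙 (X ∩ Y)) u + deg (𝟙 (X ∖ Y)) u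
    deg-split X Y u = ∑-split (λ w → trans (cong (_* 𝟙 (Γ u) w) (𝟙-split X Y w))
                                           (*-distribʳ-+ (𝟙 (Γ u) w) (𝟙 (X ∩ Y) w) (𝟙 (X ∖ Y) w)))

    deg-split₃ : ∀ f g₁ g₂ g₃ u → (∀ w → f w ≡ g₁ w + g₂ w + g₃ w) →
      deg f u ≡ deg g₁ u + deg g₂ u + deg g₃ u
    deg-split₃ f g₁ g₂ g₃ u f≗g = ∑-split₃ distrib
      where
      distrib : ∀ w → f w * 𝟙 (Γ u) w ≡ g₁ w * 𝟙 (Γ u) w + g₂ w * 𝟙 (Γ u) w + g₃ w * 𝟙 (Γ u) w
      distrib w = trans (cong (_* 𝟙 (Γ u) w) (f≗g w))
        (trans (*-distribʳ-+ (𝟙 (Γ u) w) (g₁ w + g₂ w) (g₃ w))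
               (cong (_+ g₃ w * 𝟙 (Γ u) w) (*-distribʳ-+ (𝟙 (Γ u) w) (g₁ w) (g₂ w))))

    deg-｛｝ : ∀ x u → deg (𝟙 ｛ x ｝) u ≡ 𝟙 (Γ u) x
    deg-｛｝ x u = ∑-𝟙｛｝ (𝟙 (Γ u)) x

    ∑-deg-comm : ∀ f g → ∑[ u < n ] (f u * deg g u) ≡ ∑[ w < n ] (g w * deg f w)
    ∑-deg-comm f g = begin
      ∑[ u < n ] (f u * deg g u)
        ≡⟨ sum-cong-≗ (λ u → *-distribˡ-sum (f u) (λ w → g w * 𝟙 (Γ u) w)) ⟩
      ∑[ u < n ] ∑[ w < n ] (f u * (g w * 𝟙 (Γ u) w))
        ≡⟨ ∑-comm (λ u w → f u * (g w * 𝟙 (Γ u) w)) ⟩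
      ∑[ w < n ] ∑[ u < n ] (f u * (g w * 𝟙 (Γ u) w))
        ≡⟨ sum-cong-≗ (λ w → sum-cong-≗ (reorder w)) ⟩
      ∑[ w < n ] ∑[ u < n ] (g w * (f u * 𝟙 (Γ w) u))
        ≡⟨ sum-cong-≗ (λ w → *-distribˡ-sum (g w) (λ u → f u * 𝟙 (Γ w) u)) ⟨
      ∑[ w < n ] (g w * deg f w)
        ∎
      where
      open ≡-Reasoning
      open +-*-Solver
      reorder : ∀ w u → f u * (g w * 𝟙 (Γ u) w) ≡ g w * (f u * 𝟙 (Γ w) u)
      reorder w u rewrite adj-sym G u w =
        solve 3 (λ a b e → a :* (b :* e) := b :* (a :* e)) refl (f u) (g w) (𝟙 (Γ w) u)

    -- The degrees into Y are given as a − c so that no truncated subtraction is needed.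
    double-count : ∀ {X Y : Fin n → Bool} {a b c} →
      (∀ u → X u ≡ true → c + deg (𝟙 Y) u ≡ a) → (∀ w → Y w ≡ true → deg (𝟙 X) w ≡ b) →
      ∣ X ∣ * a ≡ ∣ X ∣ * c + ∣ Y ∣ * b
    double-count {X} {Y} {a} {b} {c} degX degY = begin
      ∣ X ∣ * a
        ≡⟨ ∑-𝟙-const degX ⟨
      ∑[ u < n ] (𝟙 X u * (c + deg (𝟙 Y) u))
        ≡⟨ ∑-split (λ u → *-distribˡ-+ (𝟙 X u) c (deg (𝟙 Y) u)) ⟩
      ∑[ u < n ] (𝟙 X u * c) + ∑[ u < n ] (𝟙 X u * deg (𝟙 Y) u)
        ≡⟨ cong₂ _+_ (∑-𝟙-const {X = X} (λ _ _ → refl)) (∑-deg-comm (𝟙 X) (𝟙 Y)) ⟩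
      ∣ X ∣ * c + ∑[ w < n ] (𝟙 Y w * deg (𝟙 X) w)
        ≡⟨ cong (∣ X ∣ * c +_) (∑-𝟙-const degY) ⟩
      ∣ X ∣ * c + ∣ Y ∣ * b
        ∎
      where open ≡-Reasoning

    vertex-partition : ∀ x w → 1 ≡ 𝟙 ｛ x ｝ w + 𝟙 (Γ x) w + 𝟙 (Δ x) w
    vertex-partition x w with w ≟ x
    ... | yes refl rewrite adj-irrefl G w = refl
    ... | no _ with adj G x w
    ...   | true  = refl
    ...   | false = refl

    degree-split : ∀ x u → ∣ Γ u ∣ ≡ 𝟙 (Γ u) x + deg (𝟙 (Γ x)) u + deg (𝟙 (Δ x)) u
    degree-split x u = begin
      ∣ Γ u ∣
        ≡⟨ sum-cong-≗ (λ w → sym (*-identityˡ (𝟙 (Γ u) w))) ⟩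
      deg (λ _ → 1) u
        ≡⟨ deg-split₃ _ (𝟙 ｛ x ｝) (𝟙 (Γ x)) (𝟙 (Δ x)) u (vertex-partition x) ⟩
      deg (𝟙 ｛ x ｝) u + deg (𝟙 (Γ x)) u + deg (𝟙 (Δ x)) u
        ≡⟨ cong (λ d → d + deg (𝟙 (Γ x)) u + deg (𝟙 (Δ x)) u) (deg-｛｝ x u) ⟩
      𝟙 (Γ u) x + deg (𝟙 (Γ x)) u + deg (𝟙 (Δ x)) u
        ∎
      where open ≡-Reasoning

  -- Strongly regular graphs

  module _ {n k λ' μ} {G : Graph n} (srg : IsSRG n k λ' μ G) where
    open IsSRG srg
    open Degrees G

    ∣Γ∣≡k : ∀ u → ∣ Γ u ∣ ≡ k
    ∣Γ∣≡k u = trans (sym (valency-[u] u)) (regular u)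

    ∣Γ∩Γ∣≡μ : ∀ {u v} → u ≢ v → adj G u v ≡ false → ∣ Γ u ∩ Γ v ∣ ≡ μ
    ∣Γ∩Γ∣≡μ {u} {v} u≢v u≁v = trans (sym (valency-[u,v] u v)) (nonadjCommon u v u≢v (not-¬ u≁v))

    deg-Γ-adjacent : ∀ {u v} → adj G u v ≡ true → deg (𝟙 (Γ u)) v ≡ λ'
    deg-Γ-adjacent {u} {v} u∼v =
      trans (deg≡∣∩Γ∣ (Γ u) v) (trans (sym (valency-[u,v] u v)) (adjCommon u v u∼v))

    deg-Γ-nonadjacent : ∀ {u v} → u ≢ v → adj G u v ≡ false → deg (𝟙 (Γ u)) v ≡ μ
    deg-Γ-nonadjacent {u} {v} u≢v u≁v = trans (deg≡∣∩Γ∣ (Γ u) v) (∣Γ∩Γ∣≡μ u≢v u≁v)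

    μ+∣Γ∖Γ∣≡k : ∀ {u v} → u ≢ v → adj G u v ≡ false → μ + ∣ Γ u ∖ Γ v ∣ ≡ k
    μ+∣Γ∖Γ∣≡k {u} {v} u≢v u≁v = begin
      μ + ∣ Γ u ∖ Γ v ∣             ≡⟨ cong (_+ ∣ Γ u ∖ Γ v ∣) (∣Γ∩Γ∣≡μ u≢v u≁v) ⟨
      ∣ Γ u ∩ Γ v ∣ + ∣ Γ u ∖ Γ v ∣ ≡⟨ ∣∣-split (Γ u) (Γ v) ⟨
      ∣ Γ u ∣                       ≡⟨ ∣Γ∣≡k u ⟩
      k                             ∎
      where open ≡-Reasoning

    k[k∸λ∸1]≡∣Δ∣μ : ∀ x → k * (k ∸ λ' ∸ 1) ≡ ∣ Δ x ∣ * μ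
    k[k∸λ∸1]≡∣Δ∣μ x = begin
      k * (k ∸ λ' ∸ 1)                          ≡⟨ cong (k *_) (∸-+-assoc k λ' 1) ⟩
      k * (k ∸ (λ' + 1))                        ≡⟨ *-distribˡ-∸ k k (λ' + 1) ⟩
      k * k ∸ k * (λ' + 1)                      ≡⟨ cong (_∸ k * (λ' + 1)) counted ⟩
      k * (λ' + 1) + ∣ Δ x ∣ * μ ∸ k * (λ' + 1) ≡⟨ m+n∸m≡n (k * (λ' + 1)) _ ⟩
      ∣ Δ x ∣ * μ                               ∎
      where
      open ≡-Reasoning
      neighbour-degree : ∀ y → adj G x y ≡ true → λ' + 1 + deg (𝟙 (Δ x)) y ≡ k
      neighbour-degree y x∼y = begin
        λ' + 1 + deg (𝟙 (Δ x)) y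
          ≡⟨ cong (_+ deg (𝟙 (Δ x)) y) (+-comm λ' 1) ⟩
        1 + λ' + deg (𝟙 (Δ x)) y
          ≡⟨ cong₂ (λ a l → b2n a + l + deg (𝟙 (Δ x)) y)
                   (trans (adj-sym G y x) x∼y) (deg-Γ-adjacent x∼y) ⟨
        𝟙 (Γ y) x + deg (𝟙 (Γ x)) y + deg (𝟙 (Δ x)) y
          ≡⟨ degree-split x y ⟨
        ∣ Γ y ∣
          ≡⟨ ∣Γ∣≡k y ⟩
        k ∎
      nonneighbour-degree : ∀ w → Δ x w ≡ true → deg (𝟙 (Γ x)) w ≡ μ
      nonneighbour-degree w w∈Δx =
        let x≁w , w≢x = Δ-elim x w w∈Δx in deg-Γ-nonadjacent (w≢x ∘ sym) x≁w
      counted : k * k ≡ k * (λ' + 1) + ∣ Δ x ∣ * μ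
      counted = subst (λ s → s * k ≡ s * (λ' + 1) + ∣ Δ x ∣ * μ) (∣Γ∣≡k x)
                  (double-count neighbour-degree nonneighbour-degree)

  -- A non-edge with associated parameters R′, W′, V

  module _ {n k λ' μ} {G : Graph n} (srg : IsSRG n k λ' μ G)
           {x z : Fin n} (x≢z : x ≢ z) (x≁z : adj G x z ≡ false)
           {R' W' V : ℕ} (ap : AssocParams G x z R' W' V) where
    open AssocParams ap
    open Degrees G

    private
      z≁x : adj G z x ≡ false
      z≁x = trans (adj-sym G z x) x≁z

      edgesOn≡ : ∀ u → edgesOn G x z u ≡ b2n (adj G x u) + b2n (adj G z u)
      edgesOn≡ u rewrite x≁z = refl

    deg-Γx∩Γz≡R' : ∀ u → (Γ x ∩ Γ z) u ≡ true → deg (𝟙 (Γ x ∩ Γ z)) u ≡ R'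
    deg-Γx∩Γz≡R' u u∈ = let x∼u , z∼u = ∧-true u∈ in
      trans (sym (valency3≡deg x z u))
        (R'-val u (adj⇒≢ x∼u) (adj⇒≢ z∼u)
          (trans (edgesOn≡ u) (cong₂ (λ p q → b2n p + b2n q) x∼u z∼u)))

    deg-Γx∩Γz≡W' : ∀ w → (Γ x ∖ Γ z) w ≡ true → deg (𝟙 (Γ x ∩ Γ z)) w ≡ W'
    deg-Γx∩Γz≡W' w w∈ = let x∼w , z≁w = ∧-true w∈ in
      trans (sym (valency3≡deg x z w))
        (W'-val w (adj⇒≢ x∼w) (λ w≡z → not-¬ x≁z (subst (λ v → adj G x v ≡ true) w≡z x∼w))
          (trans (edgesOn≡ w) (cong₂ (λ p q → b2n p + b2n q) x∼w (not-injective z≁w))))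

    deg-Γx∩Γz≡V : ∀ w → (Δ x ∩ Δ z) w ≡ true → deg (𝟙 (Γ x ∩ Γ z)) w ≡ V
    deg-Γx∩Γz≡V w w∈ =
      let w∈Δx , w∈Δz = ∧-true w∈
          x≁w , w≢x = Δ-elim x w w∈Δx
          z≁w , w≢z = Δ-elim z w w∈Δz
      in trans (sym (valency3≡deg x z w))
           (V-val w w≢x w≢z (trans (edgesOn≡ w) (cong₂ (λ p q → b2n p + b2n q) x≁w z≁w)))

    Δx-partition : ∀ w → 𝟙 (Δ x) w ≡ 𝟙 (Δ x ∩ Δ z) w + 𝟙 (Γ z ∖ Γ x) w + 𝟙 ｛ z ｝ w
    Δx-partition w with w ≟ x | w ≟ z
    ... | yes refl | yes refl = ⊥-elim (x≢z refl)
    ... | yes refl | no _ rewrite adj-irrefl G w | z≁x = refl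
    ... | no _ | yes refl rewrite adj-irrefl G w | x≁z = refl
    ... | no _ | no _ with adj G x w | adj G z w
    ...   | true  | true  = refl
    ...   | true  | false = refl
    ...   | false | true  = refl
    ...   | false | false = refl

    ∣Δx∩Δz∣+1+k≡∣Δx∣+μ : ∣ Δ x ∩ Δ z ∣ + 1 + k ≡ ∣ Δ x ∣ + μ
    ∣Δx∩Δz∣+1+k≡∣Δx∣+μ = begin
      F + 1 + k             ≡⟨ cong (F + 1 +_) (μ+∣Γ∖Γ∣≡k srg (x≢z ∘ sym) z≁x) ⟨
      F + 1 + (μ + Z)       ≡⟨ solve 3 (λ f m s → f :+ con 1 :+ (m :+ s) := f :+ s :+ con 1 :+ m) refl F μ Z ⟩
      F + Z + 1 + μ         ≡⟨ cong (λ o → F + Z + o + μ) (∣｛｝∣≡1 z) ⟨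
      F + Z + ∣ ｛ z ｝ ∣ + μ ≡⟨ cong (_+ μ) (∑-split₃ Δx-partition) ⟨
      ∣ Δ x ∣ + μ           ∎
      where
      open ≡-Reasoning
      open +-*-Solver
      F Z : ℕ
      F = ∣ Δ x ∩ Δ z ∣
      Z = ∣ Γ z ∖ Γ x ∣

    R'+deg[Γx∖Γz]≡λ' : ∀ u → (Γ x ∩ Γ z) u ≡ true → R' + deg (𝟙 (Γ x ∖ Γ z)) u ≡ λ'
    R'+deg[Γx∖Γz]≡λ' u u∈ = begin
      R' + deg (𝟙 (Γ x ∖ Γ z)) u
        ≡⟨ cong (_+ deg (𝟙 (Γ x ∖ Γ z)) u) (deg-Γx∩Γz≡R' u u∈) ⟨
      deg (𝟙 (Γ x ∩ Γ z)) u + deg (𝟙 (Γ x ∖ Γ z)) u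
        ≡⟨ deg-split (Γ x) (Γ z) u ⟨
      deg (𝟙 (Γ x)) u
        ≡⟨ deg-Γ-adjacent srg (proj₁ (∧-true u∈)) ⟩
      λ' ∎
      where open ≡-Reasoning

    R'+deg[Γz∖Γx]≡λ' : ∀ u → (Γ x ∩ Γ z) u ≡ true → R' + deg (𝟙 (Γ z ∖ Γ x)) u ≡ λ'
    R'+deg[Γz∖Γx]≡λ' u u∈ = begin
      R' + deg (𝟙 (Γ z ∖ Γ x)) u
        ≡⟨ cong (_+ deg (𝟙 (Γ z ∖ Γ x)) u) (deg-Γx∩Γz≡R' u u∈) ⟨
      deg (𝟙 (Γ x ∩ Γ z)) u + deg (𝟙 (Γ z ∖ Γ x)) u
        ≡⟨ cong (_+ deg (𝟙 (Γ z ∖ Γ x)) u) ∩-comm ⟩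
      deg (𝟙 (Γ z ∩ Γ x)) u + deg (𝟙 (Γ z ∖ Γ x)) u
        ≡⟨ deg-split (Γ z) (Γ x) u ⟨
      deg (𝟙 (Γ z)) u
        ≡⟨ deg-Γ-adjacent srg (proj₂ (∧-true u∈)) ⟩
      λ' ∎
      where
      open ≡-Reasoning
      ∩-comm : deg (𝟙 (Γ x ∩ Γ z)) u ≡ deg (𝟙 (Γ z ∩ Γ x)) u
      ∩-comm = sum-cong-≗ (λ w → cong (λ p → b2n p * 𝟙 (Γ u) w) (∧-comm (adj G x w) (adj G z w)))

    2+2λ'+deg[Δx∩Δz]≡k+R' : ∀ u → (Γ x ∩ Γ z) u ≡ true →
      2 + 2 * λ' + deg (𝟙 (Δ x ∩ Δ z)) u ≡ k + R'
    2+2λ'+deg[Δx∩Δz]≡k+R' u u∈ = begin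
      2 + 2 * λ' + F
        ≡⟨ solve 2 (λ l f → con 2 :+ con 2 :* l :+ f := con 2 :+ l :+ l :+ f) refl λ' F ⟩
      2 + λ' + λ' + F
        ≡⟨ cong (λ l → 2 + λ' + l + F) (R'+deg[Γz∖Γx]≡λ' u u∈) ⟨
      2 + λ' + (R' + Z) + F
        ≡⟨ solve 4 (λ l f z r → con 2 :+ l :+ (r :+ z) :+ f := con 1 :+ l :+ (f :+ z :+ con 1) :+ r)
                 refl λ' F Z R' ⟩
      1 + λ' + (F + Z + 1) + R'
        ≡⟨ cong (_+ R') degree-of-u ⟨
      k + R'
        ∎
      where
      open ≡-Reasoning
      open +-*-Solver
      F Z : ℕ
      F = deg (𝟙 (Δ x ∩ Δ z)) u
      Z = deg (𝟙 (Γ z ∖ Γ x)) u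
      x∼u : adj G x u ≡ true
      x∼u = proj₁ (∧-true u∈)
      z∼u : adj G z u ≡ true
      z∼u = proj₂ (∧-true u∈)
      degree-of-u : k ≡ 1 + λ' + (F + Z + 1)
      degree-of-u = begin
        k
          ≡⟨ ∣Γ∣≡k srg u ⟨
        ∣ Γ u ∣
          ≡⟨ degree-split x u ⟩
        𝟙 (Γ u) x + deg (𝟙 (Γ x)) u + deg (𝟙 (Δ x)) u
          ≡⟨ cong₂ (λ a l → b2n a + l + deg (𝟙 (Δ x)) u)
                   (trans (adj-sym G u x) x∼u) (deg-Γ-adjacent srg x∼u) ⟩
        1 + λ' + deg (𝟙 (Δ x)) u
          ≡⟨ cong (1 + λ' +_)
                  (deg-split₃ _ (𝟙 (Δ x ∩ Δ z)) (𝟙 (Γ z ∖ Γ x)) (𝟙 ｛ z ｝) u Δx-partition) ⟩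
        1 + λ' + (F + Z + deg (𝟙 ｛ z ｝) u)
          ≡⟨ cong (λ o → 1 + λ' + (F + Z + o))
                  (trans (deg-｛｝ z u) (cong b2n (trans (adj-sym G u z) z∼u))) ⟩
        1 + λ' + (F + Z + 1)
          ∎

    μλ'≡μR'+∣Γx∖Γz∣W' : μ * λ' ≡ μ * R' + ∣ Γ x ∖ Γ z ∣ * W'
    μλ'≡μR'+∣Γx∖Γz∣W' =
      subst (λ s → s * λ' ≡ s * R' + ∣ Γ x ∖ Γ z ∣ * W') (∣Γ∩Γ∣≡μ srg x≢z x≁z)
        (double-count R'+deg[Γx∖Γz]≡λ' deg-Γx∩Γz≡W')

    μ[k+R']≡μ[2+2λ']+∣Δx∩Δz∣V : μ * (k + R') ≡ μ * (2 + 2 * λ') + ∣ Δ x ∩ Δ z ∣ * V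
    μ[k+R']≡μ[2+2λ']+∣Δx∩Δz∣V =
      subst (λ s → s * (k + R') ≡ s * (2 + 2 * λ') + ∣ Δ x ∩ Δ z ∣ * V) (∣Γ∩Γ∣≡μ srg x≢z x≁z)
        (double-count 2+2λ'+deg[Δx∩Δz]≡k+R' deg-Γx∩Γz≡V)

-- Transfer to ℚ

open import Data.Nat using (ℕ; NonZero)
open import Data.Integer using (+_)
open import Data.Rational using (ℚ; _/_; _+_; _-_; _*_)
import Data.Nat as ℕ
import Data.Integer as ℤ
import Data.Integer.Properties as ℤ
open import Data.Bool.Properties using (¬-not)
open import Data.Nat.Coprimality using (1-coprimeTo) renaming (sym to coprime-sym)
open import Data.Rational using (mkℚ)
open import Data.Rational.Properties using (normalize-coprime; fromℚᵘ-cong)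
open import Data.Rational.Unnormalised using (mkℚᵘ; *≡*)
open import Data.Rational.Solver using (module +-*-Solver)

ι : ℕ → ℚ
ι a = + a / 1

ι≡mkℚ : ∀ a → ι a ≡ mkℚ (+ a) 0 (coprime-sym (1-coprimeTo a))
ι≡mkℚ a = normalize-coprime (coprime-sym (1-coprimeTo a))

ι-+ : ∀ a b → ι (a ℕ.+ b) ≡ ι a + ι b
ι-+ a b = begin
  ι (a ℕ.+ b)
    ≡⟨ cong (_/ 1) (trans (ℤ.pos-+ a b) (sym (cong₂ ℤ._+_ (ℤ.*-identityʳ (+ a)) (ℤ.*-identityʳ (+ b))))) ⟩
  (+ a ℤ.* + 1 ℤ.+ + b ℤ.* + 1) / 1
    ≡⟨ cong₂ _+_ (ι≡mkℚ a) (ι≡mkℚ b) ⟨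
  ι a + ι b
    ∎
  where open ≡-Reasoning

ι-* : ∀ a b → ι (a ℕ.* b) ≡ ι a * ι b
ι-* a b = begin
  ι (a ℕ.* b)       ≡⟨ cong (_/ 1) (ℤ.pos-* a b) ⟩
  (+ a ℤ.* + b) / 1 ≡⟨ cong₂ _*_ (ι≡mkℚ a) (ι≡mkℚ b) ⟨
  ι a * ι b         ∎
  where open ≡-Reasoning

ι-/ : ∀ a m .{{_ : NonZero m}} → + (a ℕ.* m) / m ≡ ι a
ι-/ a (ℕ.suc m) = fromℚᵘ-cong {mkℚᵘ (+ (a ℕ.* ℕ.suc m)) m} {mkℚᵘ (+ a) 0}
  (*≡* (trans (ℤ.*-identityʳ (+ (a ℕ.* ℕ.suc m))) (ℤ.pos-* a (ℕ.suc m))))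

identity-i : ∀ {k λ' μ R' W' s} → μ ℕ.* λ' ≡ μ ℕ.* R' ℕ.+ s ℕ.* W' → μ ℕ.+ s ≡ k →
  ι μ * (ι λ' - ι R') ≡ (ι k - ι μ) * ι W'
identity-i {k} {λ'} {μ} {R'} {W'} {s} counted size = begin
  ι μ * (ι λ' - ι R')
    ≡⟨ solve 3 (λ m l r → m :* (l :- r) := m :* l :- m :* r) refl (ι μ) (ι λ') (ι R') ⟩
  ι μ * ι λ' - ι μ * ι R'
    ≡⟨ cong (_- ι μ * ι R') countedℚ ⟩
  ι μ * ι R' + ι s * ι W' - ι μ * ι R'
    ≡⟨ solve 4 (λ m r s w → m :* r :+ s :* w :- m :* r := (m :+ s :- m) :* w) refl (ι μ) (ι R') (ι s) (ι W') ⟩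
  (ι μ + ι s - ι μ) * ι W'
    ≡⟨ cong (λ t → (t - ι μ) * ι W') sizeℚ ⟩
  (ι k - ι μ) * ι W'
    ∎
  where
  open ≡-Reasoning
  open +-*-Solver
  countedℚ : ι μ * ι λ' ≡ ι μ * ι R' + ι s * ι W'
  countedℚ = begin
    ι μ * ι λ'                  ≡⟨ ι-* μ λ' ⟨
    ι (μ ℕ.* λ')                ≡⟨ cong ι counted ⟩
    ι (μ ℕ.* R' ℕ.+ s ℕ.* W')   ≡⟨ ι-+ (μ ℕ.* R') (s ℕ.* W') ⟩
    ι (μ ℕ.* R') + ι (s ℕ.* W') ≡⟨ cong₂ _+_ (ι-* μ R') (ι-* s W') ⟩
    ι μ * ι R' + ι s * ι W'     ∎
  sizeℚ : ι μ + ι s ≡ ι k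
  sizeℚ = trans (sym (ι-+ μ s)) (cong ι size)

identity-ii : ∀ {k λ' μ R' V f d} .{{_ : NonZero μ}} →
  μ ℕ.* (k ℕ.+ R') ≡ μ ℕ.* (2 ℕ.+ 2 ℕ.* λ') ℕ.+ f ℕ.* V → f ℕ.+ 1 ℕ.+ k ≡ d ℕ.+ μ →
  k ℕ.* (k ℕ.∸ λ' ℕ.∸ 1) ≡ d ℕ.* μ →
  ι μ * (ι k - ι 2 - ι 2 * ι λ' + ι R') ≡ ι V * (+ (k ℕ.* (k ℕ.∸ λ' ℕ.∸ 1)) / μ - ι k + ι μ - ι 1)
identity-ii {k} {λ'} {μ} {R'} {V} {f} {d} counted size quotient = begin
  ι μ * (ι k - ι 2 - ι 2 * ι λ' + ι R')
    ≡⟨ solve 5 (λ m k t l r → m :* (k :- t :- t :* l :+ r) := m :* (k :+ r) :- m :* (t :+ t :* l))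
             refl (ι μ) (ι k) (ι 2) (ι λ') (ι R') ⟩
  ι μ * (ι k + ι R') - ι μ * (ι 2 + ι 2 * ι λ')
    ≡⟨ cong (_- ι μ * (ι 2 + ι 2 * ι λ')) countedℚ ⟩
  ι μ * (ι 2 + ι 2 * ι λ') + ι f * ι V - ι μ * (ι 2 + ι 2 * ι λ')
    ≡⟨ solve 7 (λ m t l f v o k → m :* (t :+ t :* l) :+ f :* v :- m :* (t :+ t :* l)
                                  := v :* (f :+ o :+ k :- m :- k :+ m :- o))
             refl (ι μ) (ι 2) (ι λ') (ι f) (ι V) (ι 1) (ι k) ⟩
  ι V * (ι f + ι 1 + ι k - ι μ - ι k + ι μ - ι 1)
    ≡⟨ cong (λ t → ι V * (t - ι μ - ι k + ι μ - ι 1)) sizeℚ ⟩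
  ι V * (ι d + ι μ - ι μ - ι k + ι μ - ι 1)
    ≡⟨ solve 5 (λ v d m k o → v :* (d :+ m :- m :- k :+ m :- o) := v :* (d :- k :+ m :- o))
             refl (ι V) (ι d) (ι μ) (ι k) (ι 1) ⟩
  ι V * (ι d - ι k + ι μ - ι 1)
    ≡⟨ cong (λ t → ι V * (t - ι k + ι μ - ι 1)) quotientℚ ⟨
  ι V * (+ (k ℕ.* (k ℕ.∸ λ' ℕ.∸ 1)) / μ - ι k + ι μ - ι 1)
    ∎
  where
  open ≡-Reasoning
  open +-*-Solver
  countedℚ : ι μ * (ι k + ι R') ≡ ι μ * (ι 2 + ι 2 * ι λ') + ι f * ι V
  countedℚ = begin
    ι μ * (ι k + ι R')                       ≡⟨ cong (ι μ *_) (ι-+ k R') ⟨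
    ι μ * ι (k ℕ.+ R')                       ≡⟨ ι-* μ (k ℕ.+ R') ⟨
    ι (μ ℕ.* (k ℕ.+ R'))                     ≡⟨ cong ι counted ⟩
    ι (μ ℕ.* (2 ℕ.+ 2 ℕ.* λ') ℕ.+ f ℕ.* V)   ≡⟨ ι-+ (μ ℕ.* (2 ℕ.+ 2 ℕ.* λ')) (f ℕ.* V) ⟩
    ι (μ ℕ.* (2 ℕ.+ 2 ℕ.* λ')) + ι (f ℕ.* V) ≡⟨ cong₂ _+_ (ι-* μ (2 ℕ.+ 2 ℕ.* λ')) (ι-* f V) ⟩
    ι μ * ι (2 ℕ.+ 2 ℕ.* λ') + ι f * ι V     ≡⟨ cong (λ t → ι μ * t + ι f * ι V) two-two-λ ⟩
    ι μ * (ι 2 + ι 2 * ι λ') + ι f * ι V     ∎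
    where
    two-two-λ : ι (2 ℕ.+ 2 ℕ.* λ') ≡ ι 2 + ι 2 * ι λ'
    two-two-λ = trans (ι-+ 2 (2 ℕ.* λ')) (cong (_+_ (ι 2)) (ι-* 2 λ'))
  sizeℚ : ι f + ι 1 + ι k ≡ ι d + ι μ
  sizeℚ = begin
    ι f + ι 1 + ι k   ≡⟨ cong (_+ ι k) (ι-+ f 1) ⟨
    ι (f ℕ.+ 1) + ι k ≡⟨ ι-+ (f ℕ.+ 1) k ⟨
    ι (f ℕ.+ 1 ℕ.+ k) ≡⟨ cong ι size ⟩
    ι (d ℕ.+ μ)       ≡⟨ ι-+ d μ ⟩
    ι d + ι μ         ∎
  quotientℚ : + (k ℕ.* (k ℕ.∸ λ' ℕ.∸ 1)) / μ ≡ ι d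
  quotientℚ = trans (cong (λ a → + a / μ) quotient) (ι-/ d μ)

proposition3p2 : (n k λ' μ : ℕ) (G : Graph n) → IsSRG n k λ' μ G → .{{_ : NonZero μ}} →
    (x z : Fin n) → x ≢ z → ¬ (x ∼[ G ] z) → ThreeIsoregular G x z →
    (R' W' V : ℕ) → AssocParams G x z R' W' V →
    ((+ μ / 1) * ((+ λ' / 1) - (+ R' / 1)) ≡ ((+ k / 1) - (+ μ / 1)) * (+ W' / 1))
    × ((+ μ / 1) * ((+ k / 1) - (+ 2 / 1) - (+ 2 / 1) * (+ λ' / 1) + (+ R' / 1))
       ≡ (+ V / 1) * ((+ (k Data.Nat.* (k Data.Nat.∸ λ' Data.Nat.∸ 1)) / μ) - (+ k / 1) + (+ μ / 1) - (+ 1 / 1)))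
-- 3-isoregularity is not used beyond the values R′, W′, V that AssocParams records.
proposition3p2 n k λ' μ G srg x z x≢z x≁z _ R' W' V ap =
    identity-i {k} {λ'} {μ} {R'} {W'}
      (μλ'≡μR'+∣Γx∖Γz∣W' srg x≢z x≁z′ ap)
      (μ+∣Γ∖Γ∣≡k srg x≢z x≁z′)
  , identity-ii {k} {λ'} {μ} {R'} {V}
      (μ[k+R']≡μ[2+2λ']+∣Δx∩Δz∣V srg x≢z x≁z′ ap)
      (∣Δx∩Δz∣+1+k≡∣Δx∣+μ srg x≢z x≁z′ ap)
      (k[k∸λ∸1]≡∣Δ∣μ srg x)
  where
  x≁z′ : adj G x z ≡ false
  x≁z′ = ¬-not x≁z
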